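{- Let $w\in\mathfrak S_n$ with $\ell=\ell(w)$. The flip map $\varphi$ is a well-defined involution mapping $\mathrm{SBT}(w)$ to $\mathrm{SBT}(w^{ -1})$, and it satisfies $\varphi(\mathfrak c_i(R))=\mathfrak c_{\ell-i}(\varphi(R))$ and $\varphi(\mathfrak b_i(R))=\mathfrak b_{\ell-i+1}(\varphi(R))$ for all $R\in\mathrm{SBT}(w)$ and all relevant $i$.
   Context: $\ell(w)$ is the number of pairs $i<j$ with $w_i>w_j$. The Rothe diagram $\mathbb D(w)=\{(i,w_j)\mid i<j,\ w_i>w_j\}$, the cell $(i,w_j)$ lying in row $i$ (rows numbered bottom to top) and column $w_j$; it has $\ell(w)$ cells. $\mathrm{SBT}(w)$ is the set of bijective fillings of $\mathbb D(w)$ with $\{1,\ldots,\ell(w)\}$ such that for every cell, the number of cells to its right in the same row with larger entry equals the number of cells above it in the same column with smaller entry. The flip map $\varphi$ sends a filling $R$ to the filling obtained by transposing $R$ (the entry in row $r$, column $c$ moves to row $c$, column $r$) and then replacing each entry $i$ by $\ell-i+1$, where $\ell$ is the number of cells. Coxeter moves: $\mathfrak c_i$ exchanges entries $i$ and $i+1$ if they are neither in the same row nor in the same column, and is the identity otherwise; $\mathfrak b_i$ exchanges entries $i-1$ and $i+1$ if one of them lies in the same column as $i$ and above it and the other lies in the same row as $i$ and to its right, and is the identity otherwise. -}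

module Defs where

open import Data.Bool using (Bool; true; false; if_then_else_; _∧_; _∨_; not; T)
open import Data.Nat using (ℕ; zero; suc; _+_; _∸_; _≤_; _<_; _≡ᵇ_; _<ᵇ_)
open import Data.Fin using (Fin; zero; suc) renaming (_<_ to _<ᶠ_)
open import Data.Fin.Permutation using (Permutation′; _⟨$⟩ʳ_; flip)
open import Data.Product using (_×_; Σ)
open import Relation.Binary.PropositionalEquality using (_≡_)

anyᶠ : ∀ {n} → (Fin n → Bool) → Bool
anyᶠ {zero}  f = false
anyᶠ {suc n} f = f zero ∨ anyᶠ (λ i → f (suc i))

count : ∀ {n} → (Fin n → Bool) → ℕ
count {zero}  f = 0
count {suc n} f = (if f zero then 1 else 0) + count (λ i → f (suc i))

sumᶠ : ∀ {n} → (Fin n → ℕ) → ℕ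
sumᶠ {zero}  f = 0
sumᶠ {suc n} f = f zero + sumᶠ (λ i → f (suc i))

_<ᶠᵇ_ : ∀ {n} → Fin n → Fin n → Bool
zero  <ᶠᵇ zero  = false
zero  <ᶠᵇ suc _ = true
suc _ <ᶠᵇ zero  = false
suc i <ᶠᵇ suc j = i <ᶠᵇ j

_≡ᶠᵇ_ : ∀ {n} → Fin n → Fin n → Bool
zero  ≡ᶠᵇ zero  = true
zero  ≡ᶠᵇ suc _ = false
suc _ ≡ᶠᵇ zero  = false
suc i ≡ᶠᵇ suc j = i ≡ᶠᵇ j

-- Permutations of [n] = Fin n; w i is written  w ⟨$⟩ʳ i,  w⁻¹ is  flip w.

Perm : ℕ → Set
Perm = Permutation′

_⁻¹ : ∀ {n} → Perm n → Perm n
w ⁻¹ = flip w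

len : ∀ {n} → Perm n → ℕ
len w = sumᶠ (λ i → count (λ j → (i <ᶠᵇ j) ∧ ((w ⟨$⟩ʳ j) <ᶠᵇ (w ⟨$⟩ʳ i))))

-- Rothe diagram: (r , c) ∈ D(w) iff ∃ j. r < j, w_r > w_j, c = w_j.
-- Rows/columns are Fin n; larger row index = "above", larger column = "right".
inD : ∀ {n} → Perm n → Fin n → Fin n → Bool
inD w r c = anyᶠ (λ j → (r <ᶠᵇ j) ∧ ((w ⟨$⟩ʳ j) <ᶠᵇ (w ⟨$⟩ʳ r)) ∧ ((w ⟨$⟩ʳ j) ≡ᶠᵇ c))

InD : ∀ {n} → Perm n → Fin n → Fin n → Set
InD w r c = T (inD w r c)

-- Fillings: an entry for every position (row , column); positions that are
-- not cells of the diagram carry the dummy value 0 (genuine entries are ≥ 1).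

Filling : ℕ → Set
Filling n = Fin n → Fin n → ℕ

IsBijFilling : ∀ {n} → Perm n → Filling n → Set
IsBijFilling {n} w R =
  (∀ r c → ¬T (inD w r c) → R r c ≡ 0)
  × (∀ r c → InD w r c → 1 ≤ R r c × R r c ≤ len w)
  × (∀ r c r' c' → InD w r c → InD w r' c' → R r c ≡ R r' c' → r ≡ r' × c ≡ c')
  × (∀ k → 1 ≤ k → k ≤ len w → Σ (Fin n) λ r → Σ (Fin n) λ c → InD w r c × R r c ≡ k)
  where
    ¬T : Bool → Set
    ¬T b = T (not b)

IsSBT : ∀ {n} → Perm n → Filling n → Set
IsSBT w R =
  IsBijFilling w R
  × (∀ r c → InD w r c →
       count (λ c' → (c <ᶠᵇ c') ∧ inD w r c' ∧ (R r c <ᵇ R r c'))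
       ≡ count (λ r' → (r <ᶠᵇ r') ∧ inD w r' c ∧ (R r' c <ᵇ R r c)))

φ : ∀ {n} → ℕ → Filling n → Filling n
φ ℓ R r c = if R c r ≡ᵇ 0 then 0 else suc ℓ ∸ R c r

swapE : ∀ {n} → ℕ → ℕ → Filling n → Filling n
swapE a b R r c =
  if R r c ≡ᵇ a then b else (if R r c ≡ᵇ b then a else R r c)

sameRow : ∀ {n} → Filling n → ℕ → ℕ → Bool
sameRow R a b = anyᶠ (λ r → anyᶠ (λ c → anyᶠ (λ c' → (R r c ≡ᵇ a) ∧ (R r c' ≡ᵇ b))))

sameCol : ∀ {n} → Filling n → ℕ → ℕ → Bool
sameCol R a b = anyᶠ (λ c → anyᶠ (λ r → anyᶠ (λ r' → (R r c ≡ᵇ a) ∧ (R r' c ≡ᵇ b))))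

cmove : ∀ {n} → ℕ → Filling n → Filling n
cmove i R =
  if sameRow R i (suc i) ∨ sameCol R i (suc i) then R else swapE i (suc i) R

bcond : ∀ {n} → ℕ → Filling n → Bool
bcond i R = anyᶠ (λ r → anyᶠ (λ c → anyᶠ (λ r' → anyᶠ (λ c' →
  (R r c ≡ᵇ i) ∧ (r <ᶠᵇ r') ∧ (c <ᶠᵇ c') ∧
  (((R r' c ≡ᵇ (i ∸ 1)) ∧ (R r c' ≡ᵇ suc i)) ∨ ((R r' c ≡ᵇ suc i) ∧ (R r c' ≡ᵇ (i ∸ 1))))))))

bmove : ∀ {n} → ℕ → Filling n → Filling n
bmove i R = if bcond i R then swapE (i ∸ 1) (suc i) R else R

module Submission where

-- The flip map φ_ℓ transposes a filling and reverses its values on {1, …, ℓ},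
-- v ↦ ℓ + 1 - v, keeping 0 (the marker of non-cells) fixed.
--   * Rothe diagrams: (r , c) ∈ D(w) iff r < w⁻¹(c) and c < w(r).  This is
--     symmetric under (w , r , c) ↦ (w⁻¹ , c , r), so transposition maps D(w)
--     onto D(w⁻¹); reindexing the double count of inversions by w gives
--     ℓ(w⁻¹) = ℓ(w).
--   * Value reversal is an involution of {0, …, ℓ}, reverses the order of
--     {1, …, ℓ} and maps {i, i+1} to {ℓ-i, ℓ-i+1} and {i-1, i+1} to
--     {j+1, j-1} with j = ℓ-i+1.
--   * On fillings with values ≤ ℓ, φ_ℓ exchanges "same row" with "same
--     column" and "above" with "to the right", and commutes with exchanging
--     two values; so it intertwines 𝔠_i, 𝔟_i with 𝔠_{ℓ-i}, 𝔟_{ℓ-i+1}.  It maps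
--     bijective fillings of D(w) to those of D(w⁻¹), and the SBT balance
--     condition of φ(R) at (r , c) is that of R at (c , r), read backwards.

open import Defs
open import Data.Bool using (Bool; true; false; if_then_else_; _∧_; _∨_; not; T)
open import Data.Bool.Properties
  using (∧-comm; ∨-comm; ∧-assoc; ∧-identityʳ; ∧-zeroʳ; ∨-identityʳ; ∨-commutativeMonoid)
open import Data.Nat using (ℕ; zero; suc; _+_; _∸_; _≤_; _<_; _≡ᵇ_; _<ᵇ_; z≤n; s≤s)
open import Data.Nat.Properties
open import Data.Fin using (Fin; zero; suc)
open import Data.Fin.Permutation using (Permutation′; _⟨$⟩ʳ_; _⟨$⟩ˡ_; inverseˡ; inverseʳ)
open import Data.Product using (_×_; Σ; _,_; proj₂)
open import Data.Unit using (tt)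
open import Data.Empty using (⊥-elim)
open import Function using (_∘_; _⟨_⟩_)
open import Relation.Nullary using (¬_)
open import Relation.Binary.PropositionalEquality
import Algebra.Properties.CommutativeMonoid.Sum as MonoidSum

T-ext : ∀ {a b} → (T a → T b) → (T b → T a) → a ≡ b
T-ext {false} {false} _ _ = refl
T-ext {false} {true}  _ g = ⊥-elim (g tt)
T-ext {true}  {false} f _ = ⊥-elim (f tt)
T-ext {true}  {true}  _ _ = refl

∧-guarded : ∀ a d p q → (T d → p ≡ q) → a ∧ d ∧ p ≡ a ∧ d ∧ q
∧-guarded a false p q _ = refl
∧-guarded a true  p q h = cong (a ∧_) (h tt)

-- anyᶠ and sumᶠ are the big operators of the monoids (Bool, ∨) and (ℕ, +),
-- so the library's exchange and reindexing laws apply to them.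
module ⋁ = MonoidSum ∨-commutativeMonoid
module ∑ = MonoidSum +-0-commutativeMonoid

anyᶠ≡⋁ : ∀ {n} (f : Fin n → Bool) → anyᶠ f ≡ ⋁.sum f
anyᶠ≡⋁ {zero}  f = refl
anyᶠ≡⋁ {suc n} f = cong (f zero ∨_) (anyᶠ≡⋁ (f ∘ suc))

sumᶠ≡∑ : ∀ {n} (f : Fin n → ℕ) → sumᶠ f ≡ ∑.sum f
sumᶠ≡∑ {zero}  f = refl
sumᶠ≡∑ {suc n} f = cong (f zero +_) (sumᶠ≡∑ (f ∘ suc))

𝟙 : Bool → ℕ
𝟙 b = if b then 1 else 0

count≡∑ : ∀ {n} (f : Fin n → Bool) → count f ≡ ∑.sum (𝟙 ∘ f)
count≡∑ {zero}  f = refl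
count≡∑ {suc n} f = cong (𝟙 (f zero) +_) (count≡∑ (f ∘ suc))

anyᶠ-cong : ∀ {n} {f g : Fin n → Bool} → (∀ i → f i ≡ g i) → anyᶠ f ≡ anyᶠ g
anyᶠ-cong {zero}  e = refl
anyᶠ-cong {suc n} e = cong₂ _∨_ (e zero) (anyᶠ-cong (e ∘ suc))

count-cong : ∀ {n} {f g : Fin n → Bool} → (∀ i → f i ≡ g i) → count f ≡ count g
count-cong {zero}  e = refl
count-cong {suc n} e = cong₂ _+_ (cong 𝟙 (e zero)) (count-cong (e ∘ suc))

anyᶠ-false : ∀ {n} {f : Fin n → Bool} → (∀ i → f i ≡ false) → anyᶠ f ≡ false
anyᶠ-false {zero}  e = refl
anyᶠ-false {suc n} e = cong₂ _∨_ (e zero) (anyᶠ-false (e ∘ suc))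

anyᶠ-at : ∀ {n} (g : Fin n → Bool) k → anyᶠ (λ j → g j ∧ (j ≡ᶠᵇ k)) ≡ g k
anyᶠ-at g zero =
  cong₂ _∨_ (∧-identityʳ (g zero)) (anyᶠ-false (λ i → ∧-zeroʳ (g (suc i))))
  ⟨ trans ⟩ ∨-identityʳ (g zero)
anyᶠ-at g (suc k) =
  cong (_∨ anyᶠ (λ i → g (suc i) ∧ (i ≡ᶠᵇ k))) (∧-zeroʳ (g zero)) ⟨ trans ⟩ anyᶠ-at (g ∘ suc) k

anyᶠ-comm : ∀ {m n} (g : Fin m → Fin n → Bool) →
  anyᶠ (λ x → anyᶠ (g x)) ≡ anyᶠ (λ y → anyᶠ (λ x → g x y))
anyᶠ-comm g = begin
  anyᶠ (λ x → anyᶠ (g x))               ≡⟨ anyᶠ≡⋁ (λ x → anyᶠ (g x)) ⟩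
  ⋁.sum (λ x → anyᶠ (g x))              ≡⟨ ⋁.sum-cong-≗ (λ x → anyᶠ≡⋁ (g x)) ⟩
  ⋁.sum (λ x → ⋁.sum (g x))             ≡⟨ ⋁.∑-comm g ⟩
  ⋁.sum (λ y → ⋁.sum (λ x → g x y))     ≡⟨ ⋁.sum-cong-≗ (λ y → sym (anyᶠ≡⋁ (λ x → g x y))) ⟩
  ⋁.sum (λ y → anyᶠ (λ x → g x y))      ≡⟨ sym (anyᶠ≡⋁ (λ y → anyᶠ (λ x → g x y))) ⟩
  anyᶠ (λ y → anyᶠ (λ x → g x y))       ∎
  where open ≡-Reasoning

anyᶠ-permute : ∀ {n} (f : Fin n → Bool) (π : Permutation′ n) →
  anyᶠ f ≡ anyᶠ (λ i → f (π ⟨$⟩ʳ i))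
anyᶠ-permute f π =
  anyᶠ≡⋁ f ⟨ trans ⟩ (⋁.∑-permute f π ⟨ trans ⟩ sym (anyᶠ≡⋁ (λ i → f (π ⟨$⟩ʳ i))))

-- (r , c) ∈ D(w) iff r < w⁻¹(c) and c < w(r): the witness j is forced to be w⁻¹(c).
inD-char : ∀ {n} (w : Perm n) r c →
  inD w r c ≡ (r <ᶠᵇ (w ⟨$⟩ˡ c)) ∧ (c <ᶠᵇ (w ⟨$⟩ʳ r))
inD-char w r c = begin
  inD w r c
    ≡⟨ anyᶠ-permute _ (w ⁻¹) ⟩
  anyᶠ (λ k → (r <ᶠᵇ (w ⟨$⟩ˡ k)) ∧ ((w ⟨$⟩ʳ (w ⟨$⟩ˡ k)) <ᶠᵇ (w ⟨$⟩ʳ r))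
                                  ∧ ((w ⟨$⟩ʳ (w ⟨$⟩ˡ k)) ≡ᶠᵇ c))
    ≡⟨ anyᶠ-cong (λ k → cong (λ x → (r <ᶠᵇ (w ⟨$⟩ˡ k)) ∧ (x <ᶠᵇ (w ⟨$⟩ʳ r)) ∧ (x ≡ᶠᵇ c))
                              (inverseʳ w)) ⟩
  anyᶠ (λ k → (r <ᶠᵇ (w ⟨$⟩ˡ k)) ∧ (k <ᶠᵇ (w ⟨$⟩ʳ r)) ∧ (k ≡ᶠᵇ c))
    ≡⟨ anyᶠ-cong (λ k → sym (∧-assoc (r <ᶠᵇ (w ⟨$⟩ˡ k)) _ _)) ⟩
  anyᶠ (λ k → ((r <ᶠᵇ (w ⟨$⟩ˡ k)) ∧ (k <ᶠᵇ (w ⟨$⟩ʳ r))) ∧ (k ≡ᶠᵇ c))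
    ≡⟨ anyᶠ-at (λ k → (r <ᶠᵇ (w ⟨$⟩ˡ k)) ∧ (k <ᶠᵇ (w ⟨$⟩ʳ r))) c ⟩
  (r <ᶠᵇ (w ⟨$⟩ˡ c)) ∧ (c <ᶠᵇ (w ⟨$⟩ʳ r)) ∎
  where open ≡-Reasoning

inD-transpose : ∀ {n} (w : Perm n) r c → inD (w ⁻¹) r c ≡ inD w c r
inD-transpose w r c =
  inD-char (w ⁻¹) r c ⟨ trans ⟩
  (∧-comm (r <ᶠᵇ (w ⟨$⟩ʳ c)) (c <ᶠᵇ (w ⟨$⟩ˡ r)) ⟨ trans ⟩ sym (inD-char w c r))

inversion : ∀ {n} → Perm n → Fin n → Fin n → Bool
inversion w i j = (i <ᶠᵇ j) ∧ ((w ⟨$⟩ʳ j) <ᶠᵇ (w ⟨$⟩ʳ i))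

len≡∑∑ : ∀ {n} (w : Perm n) →
  len w ≡ ∑.sum (λ i → ∑.sum (λ j → 𝟙 (inversion w i j)))
len≡∑∑ w = sumᶠ≡∑ (λ i → count (inversion w i)) ⟨ trans ⟩ ∑.sum-cong-≗ (λ i → count≡∑ (inversion w i))

-- Substituting i = w(a), j = w(b) turns the inversions (i , j) of w⁻¹ into
-- the inversions (b , a) of w.
len-inverse : ∀ {n} (w : Perm n) → len (w ⁻¹) ≡ len w
len-inverse w = begin
  len (w ⁻¹)
    ≡⟨ len≡∑∑ (w ⁻¹) ⟩
  ∑.sum (λ i → ∑.sum (λ j → 𝟙 (inversion (w ⁻¹) i j)))
    ≡⟨ ∑.∑-permute _ w ⟩
  ∑.sum (λ a → ∑.sum (λ j → 𝟙 (inversion (w ⁻¹) (w ⟨$⟩ʳ a) j)))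
    ≡⟨ ∑.sum-cong-≗ (λ a → ∑.∑-permute (λ j → 𝟙 (inversion (w ⁻¹) (w ⟨$⟩ʳ a) j)) w) ⟩
  ∑.sum (λ a → ∑.sum (λ b → 𝟙 (inversion (w ⁻¹) (w ⟨$⟩ʳ a) (w ⟨$⟩ʳ b))))
    ≡⟨ ∑.sum-cong-≗ (λ a → ∑.sum-cong-≗ (λ b → cong 𝟙 (swapped a b))) ⟩
  ∑.sum (λ a → ∑.sum (λ b → 𝟙 (inversion w b a)))
    ≡⟨ ∑.∑-comm (λ a b → 𝟙 (inversion w b a)) ⟩
  ∑.sum (λ b → ∑.sum (λ a → 𝟙 (inversion w b a)))
    ≡⟨ sym (len≡∑∑ w) ⟩
  len w ∎
  where
  open ≡-Reasoning
  swapped : ∀ a b → inversion (w ⁻¹) (w ⟨$⟩ʳ a) (w ⟨$⟩ʳ b) ≡ inversion w b a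
  swapped a b rewrite inverseˡ w {a} | inverseˡ w {b} =
    ∧-comm ((w ⟨$⟩ʳ a) <ᶠᵇ (w ⟨$⟩ʳ b)) (b <ᶠᵇ a)

rev : ℕ → ℕ → ℕ
rev ℓ v = if v ≡ᵇ 0 then 0 else suc ℓ ∸ v

InRange : ℕ → ℕ → Set
InRange ℓ v = 1 ≤ v × v ≤ ℓ

rev-range : ∀ {ℓ a} → InRange ℓ a → InRange ℓ (rev ℓ a)
rev-range {ℓ} {suc a} (_ , a<ℓ) = m<n⇒0<n∸m a<ℓ , m∸n≤m ℓ a

rev-involutive : ∀ {ℓ} v → v ≤ ℓ → rev ℓ (rev ℓ v) ≡ v
rev-involutive         zero    _   = refl
rev-involutive {ℓ} (suc a) a<ℓ with ℓ ∸ a in eq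
... | zero  = ⊥-elim (<⇒≱ (m<n⇒0<n∸m a<ℓ) (≤-reflexive eq))
... | suc k = begin
  suc ℓ ∸ suc k           ≡⟨ cong (suc ℓ ∸_) (sym eq) ⟩
  suc ℓ ∸ (suc ℓ ∸ suc a) ≡⟨ m∸[m∸n]≡n (m≤n⇒m≤1+n a<ℓ) ⟩
  suc a                   ∎
  where open ≡-Reasoning

rev-injective : ∀ {ℓ x y} → x ≤ ℓ → y ≤ ℓ → rev ℓ x ≡ rev ℓ y → x ≡ y
rev-injective {ℓ} {x} {y} x≤ y≤ e =
  sym (rev-involutive x x≤) ⟨ trans ⟩ (cong (rev ℓ) e ⟨ trans ⟩ rev-involutive y y≤)

rev-≡ᵇ : ∀ {ℓ} x y → x ≤ ℓ → y ≤ ℓ → (rev ℓ x ≡ᵇ rev ℓ y) ≡ (x ≡ᵇ y)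
rev-≡ᵇ {ℓ} x y x≤ y≤ = T-ext
  (λ t → ≡⇒≡ᵇ x y (rev-injective x≤ y≤ (≡ᵇ⇒≡ (rev ℓ x) (rev ℓ y) t)))
  (λ t → ≡⇒≡ᵇ (rev ℓ x) (rev ℓ y) (cong (rev ℓ) (≡ᵇ⇒≡ x y t)))

rev-<ᵇ : ∀ {ℓ x y} → InRange ℓ x → InRange ℓ y → (rev ℓ x <ᵇ rev ℓ y) ≡ (y <ᵇ x)
rev-<ᵇ {ℓ} {suc x} {suc y} (_ , x≤) _ = T-ext
  (λ t → <⇒<ᵇ (∸-cancelʳ-< {suc x} {suc y} {suc ℓ} (<ᵇ⇒< (suc ℓ ∸ suc x) (suc ℓ ∸ suc y) t)))
  (λ t → <⇒<ᵇ (∸-monoʳ-< (<ᵇ⇒< (suc y) (suc x) t) (m≤n⇒m≤1+n x≤)))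

rev-adjacent : ∀ {ℓ} k → k < ℓ → suc (rev ℓ (suc (suc k))) ≡ rev ℓ (suc k)
rev-adjacent {ℓ} k k<ℓ = sym (+-∸-assoc 1 k<ℓ)

rev-pred : ∀ ℓ k → rev ℓ (suc k) ∸ 1 ≡ rev ℓ (suc (suc k))
rev-pred ℓ k = ∸-+-assoc ℓ k 1 ⟨ trans ⟩ cong (ℓ ∸_) (+-comm k 1)

exchange : ℕ → ℕ → ℕ → ℕ
exchange a b v = if v ≡ᵇ a then b else (if v ≡ᵇ b then a else v)

rev-exchange : ∀ {ℓ} a b v → a ≤ ℓ → b ≤ ℓ → v ≤ ℓ → ¬ a ≡ b →
  rev ℓ (exchange a b v) ≡ exchange (rev ℓ b) (rev ℓ a) (rev ℓ v)
rev-exchange a b v a≤ b≤ v≤ a≢b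
  rewrite rev-≡ᵇ v b v≤ b≤ | rev-≡ᵇ v a v≤ a≤
  with v ≡ᵇ a in va | v ≡ᵇ b in vb
... | true  | true  = ⊥-elim (a≢b (sym (≡ᵇ⇒≡ v a (subst T (sym va) tt))
                                   ⟨ trans ⟩ ≡ᵇ⇒≡ v b (subst T (sym vb) tt)))
... | true  | false = refl
... | false | true  = refl
... | false | false = refl

Bounded : ∀ {n} → ℕ → Filling n → Set
Bounded ℓ R = ∀ r c → R r c ≤ ℓ

sameLine : ∀ {n} → Filling n → ℕ → ℕ → Bool
sameLine R a b = sameRow R a b ∨ sameCol R a b

bCell : ∀ {n} → Filling n → ℕ → ℕ → ℕ → Fin n → Fin n → Fin n → Fin n → Bool
bCell R x p q r c r' c' =
  (R r c ≡ᵇ x) ∧ (r <ᶠᵇ r') ∧ (c <ᶠᵇ c') ∧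
  (((R r' c ≡ᵇ p) ∧ (R r c' ≡ᵇ q)) ∨ ((R r' c ≡ᵇ q) ∧ (R r c' ≡ᵇ p)))

-- cmove i R and bmove i R test sameLine R i (i+1) and bPattern R i (i-1) (i+1).
bPattern : ∀ {n} → Filling n → ℕ → ℕ → ℕ → Bool
bPattern R x p q = anyᶠ λ r → anyᶠ λ c → anyᶠ λ r' → anyᶠ λ c' → bCell R x p q r c r' c'

sameRow-sym : ∀ {n} (R : Filling n) a b → sameRow R a b ≡ sameRow R b a
sameRow-sym R a b = anyᶠ-cong λ r →
  anyᶠ-comm (λ c c' → (R r c ≡ᵇ a) ∧ (R r c' ≡ᵇ b)) ⟨ trans ⟩
  anyᶠ-cong (λ c' → anyᶠ-cong (λ c → ∧-comm (R r c ≡ᵇ a) (R r c' ≡ᵇ b)))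

sameCol-sym : ∀ {n} (R : Filling n) a b → sameCol R a b ≡ sameCol R b a
sameCol-sym R a b = anyᶠ-cong λ c →
  anyᶠ-comm (λ r r' → (R r c ≡ᵇ a) ∧ (R r' c ≡ᵇ b)) ⟨ trans ⟩
  anyᶠ-cong (λ r' → anyᶠ-cong (λ r → ∧-comm (R r c ≡ᵇ a) (R r' c ≡ᵇ b)))

∧-transpose : ∀ x a b u v u' v' →
  x ∧ a ∧ b ∧ ((u ∧ v) ∨ (u' ∧ v')) ≡ x ∧ b ∧ a ∧ ((v ∧ u) ∨ (v' ∧ u'))
∧-transpose false a     b     u v u' v' = refl
∧-transpose true  false false u v u' v' = refl
∧-transpose true  false true  u v u' v' = refl
∧-transpose true  true  false u v u' v' = refl
∧-transpose true  true  true  u v u' v' = cong₂ _∨_ (∧-comm u v) (∧-comm u' v')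

φ-conditional : ∀ {n} ℓ (b b' : Bool) → b' ≡ b → (F G F' G' : Filling n) →
  (∀ r c → φ ℓ F r c ≡ F' r c) → (∀ r c → φ ℓ G r c ≡ G' r c) →
  ∀ r c → φ ℓ (if b then F else G) r c ≡ (if b' then F' else G') r c
φ-conditional ℓ true  .true  refl F G F' G' hF hG = hF
φ-conditional ℓ false .false refl F G F' G' hF hG = hG

module FlipOfBounded {n} (ℓ : ℕ) (R : Filling n) (bounded : Bounded ℓ R) where

  φ-involutive : ∀ r c → φ ℓ (φ ℓ R) r c ≡ R r c
  φ-involutive r c = rev-involutive (R r c) (bounded r c)

  sameRow-φ : ∀ a b → a ≤ ℓ → b ≤ ℓ → sameRow (φ ℓ R) (rev ℓ a) (rev ℓ b) ≡ sameCol R a b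
  sameRow-φ a b a≤ b≤ = anyᶠ-cong λ x → anyᶠ-cong λ y → anyᶠ-cong λ y' →
    cong₂ _∧_ (rev-≡ᵇ (R y x) a (bounded y x) a≤) (rev-≡ᵇ (R y' x) b (bounded y' x) b≤)

  sameCol-φ : ∀ a b → a ≤ ℓ → b ≤ ℓ → sameCol (φ ℓ R) (rev ℓ a) (rev ℓ b) ≡ sameRow R a b
  sameCol-φ a b a≤ b≤ = anyᶠ-cong λ x → anyᶠ-cong λ y → anyᶠ-cong λ y' →
    cong₂ _∧_ (rev-≡ᵇ (R x y) a (bounded x y) a≤) (rev-≡ᵇ (R x y') b (bounded x y') b≤)

  sameLine-φ : ∀ a b → a ≤ ℓ → b ≤ ℓ → sameLine (φ ℓ R) (rev ℓ a) (rev ℓ b) ≡ sameLine R b a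
  sameLine-φ a b a≤ b≤ =
    cong₂ _∨_ (sameRow-φ a b a≤ b≤ ⟨ trans ⟩ sameCol-sym R a b)
              (sameCol-φ a b a≤ b≤ ⟨ trans ⟩ sameRow-sym R a b)
    ⟨ trans ⟩ ∨-comm (sameCol R b a) (sameRow R b a)

  bCell-φ : ∀ x p q → x ≤ ℓ → p ≤ ℓ → q ≤ ℓ → ∀ r c r' c' →
    bCell (φ ℓ R) (rev ℓ x) (rev ℓ q) (rev ℓ p) r c r' c' ≡ bCell R x p q c r c' r'
  bCell-φ x p q x≤ p≤ q≤ r c r' c'
    rewrite rev-≡ᵇ (R c r) x (bounded c r) x≤
          | rev-≡ᵇ (R c r') q (bounded c r') q≤ | rev-≡ᵇ (R c' r) p (bounded c' r) p≤
          | rev-≡ᵇ (R c r') p (bounded c r') p≤ | rev-≡ᵇ (R c' r) q (bounded c' r) q≤ =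
    ∧-transpose (R c r ≡ᵇ x) (r <ᶠᵇ r') (c <ᶠᵇ c')
      (R c r' ≡ᵇ q) (R c' r ≡ᵇ p) (R c r' ≡ᵇ p) (R c' r ≡ᵇ q)

  bPattern-φ : ∀ x p q → x ≤ ℓ → p ≤ ℓ → q ≤ ℓ →
    bPattern (φ ℓ R) (rev ℓ x) (rev ℓ q) (rev ℓ p) ≡ bPattern R x p q
  bPattern-φ x p q x≤ p≤ q≤ =
    (anyᶠ-cong λ r → anyᶠ-cong λ c → anyᶠ-cong λ r' → anyᶠ-cong λ c' →
       bCell-φ x p q x≤ p≤ q≤ r c r' c')
    ⟨ trans ⟩ anyᶠ-comm (λ r c → anyᶠ λ r' → anyᶠ λ c' → bCell R x p q c r c' r')
    ⟨ trans ⟩ (anyᶠ-cong λ c → anyᶠ-cong λ r → anyᶠ-comm (λ r' c' → bCell R x p q c r c' r'))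

  φ-swapE : ∀ a b → a ≤ ℓ → b ≤ ℓ → ¬ a ≡ b → ∀ r c →
    φ ℓ (swapE a b R) r c ≡ swapE (rev ℓ b) (rev ℓ a) (φ ℓ R) r c
  φ-swapE a b a≤ b≤ a≢b r c = rev-exchange a b (R c r) a≤ b≤ (bounded c r) a≢b

  -- φ intertwines 𝔠_i with 𝔠_{ℓ-i}: the pair {i, i+1} becomes {ℓ-i, ℓ-i+1}.
  φ-cmove : ∀ i → 1 ≤ i → i < ℓ → ∀ r c →
    φ ℓ (cmove i R) r c ≡ cmove (ℓ ∸ i) (φ ℓ R) r c
  φ-cmove i@(suc k) _ i<ℓ =
    φ-conditional ℓ (sameLine R i (suc i)) _ condition R (swapE i (suc i) R) _ _
      (λ _ _ → refl)
      (λ r c → φ-swapE i (suc i) (<⇒≤ i<ℓ) i<ℓ (λ ()) r c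
               ⟨ trans ⟩ cong (λ v → swapE (ℓ ∸ i) v (φ ℓ R) r c) (sym upper))
    where
    upper : suc (ℓ ∸ i) ≡ rev ℓ i
    upper = rev-adjacent k (≤-trans (n≤1+n i) i<ℓ)
    condition : sameLine (φ ℓ R) (ℓ ∸ i) (suc (ℓ ∸ i)) ≡ sameLine R i (suc i)
    condition = cong (sameLine (φ ℓ R) (ℓ ∸ i)) upper
                ⟨ trans ⟩ sameLine-φ (suc i) i i<ℓ (<⇒≤ i<ℓ)

  -- φ intertwines 𝔟_i with 𝔟_j, j = ℓ-i+1: the values i-1, i, i+1 become j+1, j, j-1.
  φ-bmove : ∀ i → 2 ≤ i → i < ℓ → ∀ r c →
    φ ℓ (bmove i R) r c ≡ bmove (suc ℓ ∸ i) (φ ℓ R) r c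
  φ-bmove (suc zero) (s≤s ()) _
  φ-bmove i@(suc (suc k)) _ i<ℓ =
    φ-conditional ℓ (bcond i R) _ condition (swapE (i ∸ 1) (suc i) R) R _ _
      (λ r c → φ-swapE (i ∸ 1) (suc i) i-1≤ i<ℓ i-1≢i+1 r c
               ⟨ trans ⟩ cong₂ (λ u v → swapE u v (φ ℓ R) r c) (sym lower) (sym upper))
      (λ _ _ → refl)
    where
    j : ℕ
    j = suc ℓ ∸ i
    i-1≤ : i ∸ 1 ≤ ℓ
    i-1≤ = ≤-trans (n≤1+n (suc k)) (<⇒≤ i<ℓ)
    i-1≢i+1 : ¬ i ∸ 1 ≡ suc i
    i-1≢i+1 ()
    lower : j ∸ 1 ≡ rev ℓ (suc i)
    lower = rev-pred ℓ (suc k)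
    upper : suc j ≡ rev ℓ (i ∸ 1)
    upper = rev-adjacent k (≤-trans (n≤1+n (suc k)) (≤-trans (n≤1+n i) i<ℓ))
    condition : bcond j (φ ℓ R) ≡ bcond i R
    condition = cong₂ (bPattern (φ ℓ R) j) lower upper
                ⟨ trans ⟩ bPattern-φ i (i ∸ 1) (suc i) (<⇒≤ i<ℓ) i-1≤ i<ℓ

Balanced : ∀ {n} → Perm n → Filling n → Set
Balanced w R =
  ∀ r c → InD w r c →
    count (λ c' → (c <ᶠᵇ c') ∧ inD w r c' ∧ (R r c <ᵇ R r c'))
    ≡ count (λ r' → (r <ᶠᵇ r') ∧ inD w r' c ∧ (R r' c <ᵇ R r c))

bijFilling-bounded : ∀ {n} (w : Perm n) (R : Filling n) → IsBijFilling w R → Bounded (len w) R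
bijFilling-bounded w R (empty , range , _) r c with inD w r c in e
... | true  = proj₂ (range r c (subst T (sym e) tt))
... | false = subst (_≤ len w) (sym (empty r c (subst (T ∘ not) (sym e) tt))) z≤n

-- φ maps bijective fillings of D(w) to bijective fillings of D(w⁻¹): transposition
-- matches the cells, reversal is a bijection of {1, …, ℓ(w)} = {1, …, ℓ(w⁻¹)}.
φ-bijFilling : ∀ {n} (w : Perm n) (R : Filling n) →
  IsBijFilling w R → IsBijFilling (w ⁻¹) (φ (len w) R)
φ-bijFilling {n} w R bij@(empty , range , injective , surjective) =
  empty′ , range′ , injective′ , surjective′
  where
  ℓ : ℕ
  ℓ = len w
  bounded : Bounded ℓ R
  bounded = bijFilling-bounded w R bij
  transposed : ∀ r c → InD (w ⁻¹) r c → InD w c r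
  transposed r c = subst T (inD-transpose w r c)
  ℓ≡ : ℓ ≡ len (w ⁻¹)
  ℓ≡ = sym (len-inverse w)

  empty′ : ∀ r c → T (not (inD (w ⁻¹) r c)) → φ ℓ R r c ≡ 0
  empty′ r c t = cong (rev ℓ) (empty c r (subst (T ∘ not) (inD-transpose w r c) t))

  range′ : ∀ r c → InD (w ⁻¹) r c → InRange (len (w ⁻¹)) (φ ℓ R r c)
  range′ r c t = subst (λ m → InRange m (φ ℓ R r c)) ℓ≡
    (rev-range {ℓ} {R c r} (range c r (transposed r c t)))

  injective′ : ∀ r c r' c' → InD (w ⁻¹) r c → InD (w ⁻¹) r' c' →
    φ ℓ R r c ≡ φ ℓ R r' c' → r ≡ r' × c ≡ c'
  injective′ r c r' c' t t' e
    with injective c r c' r' (transposed r c t) (transposed r' c' t')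
                   (rev-injective {ℓ} {R c r} {R c' r'} (bounded c r) (bounded c' r') e)
  ... | c≡c' , r≡r' = r≡r' , c≡c'

  surjective′ : ∀ k → 1 ≤ k → k ≤ len (w ⁻¹) →
    Σ (Fin n) λ r → Σ (Fin n) λ c → InD (w ⁻¹) r c × φ ℓ R r c ≡ k
  surjective′ k 1≤k k≤ with rev-range (1≤k , subst (k ≤_) (sym ℓ≡) k≤)
  ... | 1≤k′ , k′≤ with surjective (rev ℓ k) 1≤k′ k′≤
  ... | r , c , t , e =
    c , r , subst T (sym (inD-transpose w c r)) t ,
    (cong (rev ℓ) e ⟨ trans ⟩ rev-involutive k (subst (k ≤_) (sym ℓ≡) k≤))

-- The balance condition of φ(R) at (r , c) is that of R at (c , r), read backwards:
-- larger entries to the right become smaller entries above, and vice versa.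
φ-balanced : ∀ {n} (w : Perm n) (R : Filling n) →
  IsBijFilling w R → Balanced w R → Balanced (w ⁻¹) (φ (len w) R)
φ-balanced w R (_ , range , _) balanced r c t =
  rightward ⟨ trans ⟩ (sym (balanced c r t′) ⟨ trans ⟩ sym upward)
  where
  ℓ : ℕ
  ℓ = len w
  t′ : InD w c r
  t′ = subst T (inD-transpose w r c) t
  rightward : count (λ c' → (c <ᶠᵇ c') ∧ inD (w ⁻¹) r c' ∧ (φ ℓ R r c <ᵇ φ ℓ R r c'))
            ≡ count (λ x → (c <ᶠᵇ x) ∧ inD w x r ∧ (R x r <ᵇ R c r))
  rightward = count-cong λ x →
    cong (λ d → (c <ᶠᵇ x) ∧ d ∧ (φ ℓ R r c <ᵇ φ ℓ R r x)) (inD-transpose w r x)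
    ⟨ trans ⟩ ∧-guarded (c <ᶠᵇ x) (inD w x r) _ _ (λ tx → rev-<ᵇ (range c r t′) (range x r tx))
  upward : count (λ r' → (r <ᶠᵇ r') ∧ inD (w ⁻¹) r' c ∧ (φ ℓ R r' c <ᵇ φ ℓ R r c))
         ≡ count (λ y → (r <ᶠᵇ y) ∧ inD w c y ∧ (R c r <ᵇ R c y))
  upward = count-cong λ y →
    cong (λ d → (r <ᶠᵇ y) ∧ d ∧ (φ ℓ R y c <ᵇ φ ℓ R r c)) (inD-transpose w y c)
    ⟨ trans ⟩ ∧-guarded (r <ᶠᵇ y) (inD w c y) _ _ (λ ty → rev-<ᵇ (range c y ty) (range c r t′))

proposition4p3 : ∀ n (w : Perm n) (R : Filling n) → IsSBT w R →
    IsSBT (w ⁻¹) (φ (len w) R)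
    × (∀ r c → φ (len (w ⁻¹)) (φ (len w) R) r c ≡ R r c)
    × (∀ i → 1 ≤ i → i < len w → ∀ r c →
         φ (len w) (cmove i R) r c ≡ cmove (len w ∸ i) (φ (len w) R) r c)
    × (∀ i → 2 ≤ i → i < len w → ∀ r c →
         φ (len w) (bmove i R) r c ≡ bmove (suc (len w) ∸ i) (φ (len w) R) r c)
proposition4p3 n w R (bij , balanced) =
    (φ-bijFilling w R bij , φ-balanced w R bij balanced)
  , involutive
  , φ-cmove
  , φ-bmove
  where
  open FlipOfBounded (len w) R (bijFilling-bounded w R bij)
  involutive : ∀ r c → φ (len (w ⁻¹)) (φ (len w) R) r c ≡ R r c
  involutive r c = cong (λ m → φ m (φ (len w) R) r c) (len-inverse w) ⟨ trans ⟩ φ-involutive r c
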